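{- Let $1\le k\le m-1$ and let $\sigma\in S_m$ be a pattern with an overlap at $k$. Suppose $\tau\in S_{2m-k}$ satisfies $\mathrm{st}(\tau_1,\dots,\tau_m)=\sigma$ and $\mathrm{st}(\tau_{m-k+1},\dots,\tau_{2m-k})=\sigma$. Let $\sigma'=\mathrm{st}(\sigma_{m-k+1},\dots,\sigma_m)\in S_k$. Then for every $0\le i<k$, $$\tau_{m-i}=\sigma_{k-i}+\sigma_{m-i}-\sigma'_{k-i}.$$
   Context: $S_n$ denotes the set of permutations of $\{1,\dots,n\}$. For distinct integers $x_1,\dots,x_k$, $\mathrm{st}(x_1,\dots,x_k)\in S_k$ is the permutation obtained by replacing each entry by its rank among $x_1,\dots,x_k$. A pattern $\sigma\in S_m$ has an overlap at $k$ if $\mathrm{st}(\sigma_1,\dots,\sigma_k)=\mathrm{st}(\sigma_{m-k+1},\dots,\sigma_m)$. -}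

module Defs where

open import Data.Nat using (ℕ; zero; suc; _+_; _∸_; _<_; _<?_)
open import Data.Fin using (Fin; toℕ; fromℕ<)
open import Data.Fin.Permutation using (Permutation′; _⟨$⟩ʳ_)
open import Data.List using (length; filter; upTo)
open import Relation.Nullary using (yes; no)

-- A permutation π ∈ S_n, written in one-line notation as a 1-indexed word:
-- ent π j = π_j ∈ {1,…,n} for 1 ≤ j ≤ n (and 0 outside this range, unused).
ent : {n : ℕ} → Permutation′ n → ℕ → ℕ
ent {n} π zero = 0
ent {n} π (suc j) with j <? n
... | yes j<n = suc (toℕ (π ⟨$⟩ʳ fromℕ< j<n))
... | no _    = 0

-- A word x_1 … x_k is represented as a function on indices 1..k.
-- st x k j = rank of x_j among x_1,…,x_k, i.e. 1 + #{ l ∈ [1,k] : x_l < x_j }.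
st : (ℕ → ℕ) → ℕ → ℕ → ℕ
st x k j = suc (length (filter (λ l → x (suc l) <? x j) (upTo k)))

window : (ℕ → ℕ) → ℕ → ℕ → ℕ
window x o j = x (o + j)

_≡[_]_ : (ℕ → ℕ) → ℕ → (ℕ → ℕ) → Set
x ≡[ len ] y = ∀ j → 1 Data.Nat.≤ j → j Data.Nat.≤ len → x j ≡ y j
  where open import Relation.Binary.PropositionalEquality using (_≡_)

HasOverlap : {m : ℕ} → Permutation′ m → ℕ → Set
HasOverlap {m} σ k = st (ent σ) k ≡[ k ] st (window (ent σ) (m ∸ k)) k

module Submission where

-- Write T = τ, o = m - k (so the two copies of σ inside τ start after 0 and
-- after o), p = m - i and r = k - i, so that position p of τ is position p of
-- the first copy and position r of the second copy.  Every entry of a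
-- permutation, or of a standardised word, is one more than the number of
-- entries below it.  Counting the entries of τ below v = τ_p block by block,
-- with X = #{1 ≤ l ≤ o : τ_l < v}, B = #{1 ≤ l ≤ m : τ_{o+l} < v} and
-- C = #{1 ≤ l ≤ k : τ_{o+l} < v}, gives
--   τ_p = 1 + X + B,  σ_p = 1 + X + C,  σ_r = 1 + B,  σ'_r = 1 + C,
-- the last because standardising preserves relative order.  Hence
-- τ_p = σ_r + σ_p - σ'_r.
-- The module Counting develops the counting function `below`, its relation
-- to `st` and to permutations, and how standardisation interacts with windows;
-- overlap-entry derives the four counts above and the identity in the
-- coordinates o, r, and lemma3 only translates the indices.

open import Defs
open import Data.Nat using (ℕ; _∸_; _≤_; _<_; _*_)
open import Data.Fin.Permutation using (Permutation′)
open import Relation.Binary.PropositionalEquality using (_≡_)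

module Counting where

  open import Data.Nat using (zero; suc; _+_; z≤n; s≤s; s≤s⁻¹; _<?_)
  open import Data.Nat.Properties
  open import Data.Bool using (if_then_else_)
  open import Data.Fin using (toℕ; fromℕ<)
  open import Data.Fin.Properties using (toℕ<n; fromℕ<-toℕ)
  open import Data.Fin.Permutation using (_⟨$⟩ʳ_)
  open import Data.List using (length; filter; applyUpTo)
  open import Data.List.Properties using (filter-accept; filter-reject)
  open import Relation.Nullary using (¬_; does; yes; no; contradiction)
  open import Relation.Nullary.Decidable using (dec-true; dec-false)
  open import Relation.Binary.PropositionalEquality
    using (refl; sym; trans; cong; cong₂; module ≡-Reasoning)
  open import Algebra.Properties.CommutativeMonoid.Sum +-0-commutativeMonoid
    using (sum; sum-permute; sum-cong-≗)
  open ≡-Reasoning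

  -- The indicator of a < b.  It is kept opaque: it is only ever used
  -- through ind-yes and ind-no, and unfolding it would hinder unification.
  opaque
    ind : ℕ → ℕ → ℕ
    ind a b = if does (a <? b) then 1 else 0

    ind-yes : ∀ {a b} → a < b → ind a b ≡ 1
    ind-yes {a} {b} a<b rewrite dec-true (a <? b) a<b = refl

    ind-no : ∀ {a b} → ¬ a < b → ind a b ≡ 0
    ind-no {a} {b} a≮b rewrite dec-false (a <? b) a≮b = refl

  ind-suc : ∀ a b → ind (suc a) (suc b) ≡ ind a b
  ind-suc a b with a <? b
  ... | yes a<b = trans (ind-yes (s≤s a<b)) (sym (ind-yes a<b))
  ... | no a≮b = trans (ind-no (λ sa<sb → a≮b (s≤s⁻¹ sa<sb))) (sym (ind-no a≮b))

  ind-monoʳ : ∀ a {b c} → b ≤ c → ind a b ≤ ind a c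
  ind-monoʳ a {b} b≤c with a <? b
  ... | yes a<b = ≤-reflexive (trans (ind-yes a<b) (sym (ind-yes (<-≤-trans a<b b≤c))))
  ... | no a≮b = ≤-trans (≤-reflexive (ind-no a≮b)) z≤n

  -- sum< n f = f 0 + … + f (n - 1), as a Fin-indexed sum so that the
  -- permutation invariance of sums is available; it unfolds definitionally
  -- as sum< (suc n) f = f 0 + sum< n (f ∘ suc).
  sum< : ℕ → (ℕ → ℕ) → ℕ
  sum< n f = sum {n} (λ l → f (toℕ l))

  sum<-split : ∀ a b f → sum< (a + b) f ≡ sum< a f + sum< b (λ l → f (a + l))
  sum<-split zero b f = refl
  sum<-split (suc a) b f =
    trans (cong (f 0 +_) (sum<-split a b (λ l → f (suc l)))) (sym (+-assoc (f 0) _ _))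

  sum<-cong : ∀ n {f g} → (∀ l → l < n → f l ≡ g l) → sum< n f ≡ sum< n g
  sum<-cong zero f≗g = refl
  sum<-cong (suc n) f≗g =
    cong₂ _+_ (f≗g 0 (s≤s z≤n)) (sum<-cong n (λ l l<n → f≗g (suc l) (s≤s l<n)))

  sum<-mono : ∀ n {f g} → (∀ l → l < n → f l ≤ g l) → sum< n f ≤ sum< n g
  sum<-mono zero f≤g = z≤n
  sum<-mono (suc n) f≤g =
    +-mono-≤ (f≤g 0 (s≤s z≤n)) (sum<-mono n (λ l l<n → f≤g (suc l) (s≤s l<n)))

  sum<-strict : ∀ n {f g} → (∀ l → l < n → f l ≤ g l) →
    ∀ j → j < n → f j < g j → sum< n f < sum< n g
  sum<-strict (suc n) f≤g zero _ fj<gj =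
    +-mono-<-≤ fj<gj (sum<-mono n (λ l l<n → f≤g (suc l) (s≤s l<n)))
  sum<-strict (suc n) f≤g (suc j) (s≤s j<n) fj<gj =
    +-mono-≤-< (f≤g 0 (s≤s z≤n)) (sum<-strict n (λ l l<n → f≤g (suc l) (s≤s l<n)) j j<n fj<gj)

  sum<-ind-count : ∀ n c → c ≤ n → sum< n (λ l → ind l c) ≡ c
  sum<-ind-count zero zero _ = refl
  sum<-ind-count (suc n) zero _ =
    trans (sum<-cong (suc n) {λ l → ind l 0} {λ _ → 0} (λ l _ → ind-no {l} {0} (λ ()))) (sum-zero (suc n))
    where
    sum-zero : ∀ n → sum< n (λ _ → 0) ≡ 0
    sum-zero zero = refl
    sum-zero (suc n) = sum-zero n
  sum<-ind-count (suc n) (suc c) (s≤s c≤n) =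
    trans (cong₂ _+_ (ind-yes (s≤s z≤n)) (sum<-cong n (λ l _ → ind-suc l c)))
          (cong suc (sum<-ind-count n c c≤n))

  below : (ℕ → ℕ) → ℕ → ℕ → ℕ
  below x v n = sum< n (λ l → ind (x (suc l)) v)

  length-filter : ∀ (y : ℕ → ℕ) v g n →
    length (filter (λ l → y l <? v) (applyUpTo g n)) ≡ sum< n (λ l → ind (y (g l)) v)
  length-filter y v g zero = refl
  length-filter y v g (suc n) with y (g 0) <? v
  ... | yes lt = trans (cong length (filter-accept (λ l → y l <? v) lt))
                       (trans (cong suc rest) (cong (_+ rhs) (sym (ind-yes lt))))
    where rest = length-filter y v (λ l → g (suc l)) n
          rhs = sum< n (λ l → ind (y (g (suc l))) v)
  ... | no nlt = trans (cong length (filter-reject (λ l → y l <? v) nlt))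
                       (trans rest (cong (_+ rhs) (sym (ind-no nlt))))
    where rest = length-filter y v (λ l → g (suc l)) n
          rhs = sum< n (λ l → ind (y (g (suc l))) v)

  st-below : ∀ x k j → st x k j ≡ suc (below x (x j) k)
  st-below x k j = cong suc (length-filter (λ l → x (suc l)) (x j) (λ l → l) k)

  below-split : ∀ x v a b → below x v (a + b) ≡ below x v a + below (window x a) v b
  below-split x v a b =
    trans (sum<-split a b (λ l → ind (x (suc l)) v))
          (cong (below x v a +_) (sum<-cong b (λ l _ → cong (λ q → ind (x q) v) (sym (+-suc a l)))))

  st-cong : ∀ {x y k} j → x ≡[ k ] y → 1 ≤ j → j ≤ k → st x k j ≡ st y k j
  st-cong {x} {y} {k} j x≡y 1≤j j≤k = begin
    st x k j                  ≡⟨ st-below x k j ⟩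
    suc (below x (x j) k)     ≡⟨ cong suc (sum<-cong k λ l l<k →
                                   cong₂ ind (x≡y (suc l) (s≤s z≤n) l<k) (x≡y j 1≤j j≤k)) ⟩
    suc (below y (y j) k)     ≡⟨ st-below y k j ⟨
    st y k j                  ∎

  ≡[]-window : ∀ {x y m} o k → x ≡[ m ] y → o + k ≤ m → window x o ≡[ k ] window y o
  ≡[]-window o k x≡y o+k≤m j 1≤j j≤k =
    x≡y (o + j) (≤-trans 1≤j (m≤n+m j o)) (≤-trans (+-monoʳ-≤ o j≤k) o+k≤m)

  ≡[]-sym : ∀ {x y m} → x ≡[ m ] y → y ≡[ m ] x
  ≡[]-sym x≡y j 1≤j j≤m = sym (x≡y j 1≤j j≤m)

  st-mono : ∀ x k a b → x a ≤ x b → st x k a ≤ st x k b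
  st-mono x k a b xa≤xb rewrite st-below x k a | st-below x k b =
    s≤s (sum<-mono k (λ l _ → ind-monoʳ (x (suc l)) xa≤xb))

  st-strict : ∀ x k q b → 1 ≤ q → q ≤ k → x q < x b → st x k q < st x k b
  st-strict x k (suc q) b _ q<k xq<xb rewrite st-below x k (suc q) | st-below x k b =
    s≤s (sum<-strict k (λ l _ → ind-monoʳ (x (suc l)) (<⇒≤ xq<xb)) q q<k strict)
    where
    strict : ind (x (suc q)) (x (suc q)) < ind (x (suc q)) (x b)
    strict rewrite ind-no (<-irrefl (refl {x = x (suc q)})) | ind-yes xq<xb = s≤s z≤n

  st-ind : ∀ x k q p → 1 ≤ q → q ≤ k → ind (st x k q) (st x k p) ≡ ind (x q) (x p)
  st-ind x k q p 1≤q q≤k with x q <? x p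
  ... | yes xq<xp = trans (ind-yes (st-strict x k q p 1≤q q≤k xq<xp)) (sym (ind-yes xq<xp))
  ... | no xq≮xp = trans (ind-no (λ lt → <⇒≱ lt (st-mono x k p q (≮⇒≥ xq≮xp))))
                         (sym (ind-no xq≮xp))

  st-window-st : ∀ x m o k r → o + k ≤ m →
    st (window (st x m) o) k r ≡ st (window x o) k r
  st-window-st x m o k r o+k≤m = begin
    st (window (st x m) o) k r
      ≡⟨ st-below (window (st x m) o) k r ⟩
    suc (sum< k (λ l → ind (st x m (o + suc l)) (st x m (o + r))))
      ≡⟨ cong suc (sum<-cong k λ l l<k → st-ind x m (o + suc l) (o + r)
           (≤-trans (s≤s z≤n) (m≤n+m (suc l) o)) (≤-trans (+-monoʳ-≤ o l<k) o+k≤m)) ⟩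
    suc (below (window x o) (x (o + r)) k)
      ≡⟨ st-below (window x o) k r ⟨
    st (window x o) k r
      ∎

  perm-rank : ∀ {n} (π : Permutation′ n) q →
    toℕ (π ⟨$⟩ʳ q) ≡ sum (λ i → ind (toℕ (π ⟨$⟩ʳ i)) (toℕ (π ⟨$⟩ʳ q)))
  perm-rank {n} π q = begin
    c                                   ≡⟨ sum<-ind-count n c (<⇒≤ (toℕ<n (π ⟨$⟩ʳ q))) ⟨
    sum< n (λ l → ind l c)              ≡⟨ sum-permute (λ j → ind (toℕ j) c) π ⟩
    sum (λ i → ind (toℕ (π ⟨$⟩ʳ i)) c)  ∎
    where c = toℕ (π ⟨$⟩ʳ q)

  ent-fromℕ< : ∀ {n} (π : Permutation′ n) p (p<n : p < n) →
    ent π (suc p) ≡ suc (toℕ (π ⟨$⟩ʳ fromℕ< p<n))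
  ent-fromℕ< {n} π p p<n with p <? n
  ... | yes _ = refl
  ... | no p≮n = contradiction p<n p≮n

  ent-toℕ : ∀ {n} (π : Permutation′ n) i → ent π (suc (toℕ i)) ≡ suc (toℕ (π ⟨$⟩ʳ i))
  ent-toℕ π i = trans (ent-fromℕ< π (toℕ i) (toℕ<n i))
                      (cong (λ z → suc (toℕ (π ⟨$⟩ʳ z))) (fromℕ<-toℕ i (toℕ<n i)))

  ent-rank : ∀ {n} (π : Permutation′ n) p → 1 ≤ p → p ≤ n →
    ent π p ≡ suc (below (ent π) (ent π p) n)
  ent-rank {n} π (suc p) _ p<n = begin
    ent π (suc p)                             ≡⟨ ent-fromℕ< π p p<n ⟩
    suc (toℕ (π ⟨$⟩ʳ q))                      ≡⟨ cong suc (perm-rank π q) ⟩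
    suc (sum (λ i → ind (toℕ (π ⟨$⟩ʳ i)) (toℕ (π ⟨$⟩ʳ q))))
      ≡⟨ cong suc (sum-cong-≗ λ i → trans (sym (ind-suc _ _))
           (cong₂ ind (sym (ent-toℕ π i)) (sym (ent-fromℕ< π p p<n)))) ⟩
    suc (below (ent π) (ent π (suc p)) n)     ∎
    where q = fromℕ< p<n

open Counting

open import Data.Nat as ℕ using (suc)
open import Data.Nat.Properties
  using (≤-trans; ≤-reflexive; <⇒≤; m≤n+m; +-monoʳ-≤; m∸n+n≡m; m∸n≤m; +-∸-assoc; +-∸-comm; +-identityʳ; m<n⇒0<n∸m)
open import Data.Integer using (ℤ; +_; _+_; _-_; 1ℤ)
open import Data.Integer.Properties using (pos-+)
open import Data.Integer.Tactic.RingSolver using (solve-∀)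
open import Relation.Binary.PropositionalEquality using (refl; sym; trans; cong; subst)

rank-arith : ∀ {t a s c′} x b c → t ≡ suc (x ℕ.+ b) → a ≡ suc b →
  s ≡ suc (x ℕ.+ c) → c′ ≡ suc c → + t ≡ (+ a + + s) - + c′
rank-arith x b c refl refl refl refl
  rewrite pos-+ (suc x) b | pos-+ (suc x) c | pos-+ 1 x | pos-+ 1 b | pos-+ 1 c
  = identity (+ x) (+ b) (+ c)
  where
  identity : ∀ (x b c : ℤ) → 1ℤ + x + b ≡ ((1ℤ + b) + (1ℤ + x + c)) - (1ℤ + c)
  identity = solve-∀

-- The theorem in the coordinates o = m - k and r = k - i: τ has length
-- o + m, its windows of length m after offsets 0 and o standardise to σ, and
-- position p = o + r of τ is position r of the second window.
overlap-entry : ∀ {m N} o k r → o ℕ.+ k ≡ m → N ≡ o ℕ.+ m → 1 ≤ r → r ≤ k →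
  (σ : Permutation′ m) (τ : Permutation′ N) →
  st (ent τ) m ≡[ m ] ent σ → st (window (ent τ) o) m ≡[ m ] ent σ →
  + ent τ (o ℕ.+ r) ≡ (+ ent σ r + + ent σ (o ℕ.+ r)) - + st (window (ent σ) o) k r
overlap-entry {m} {N} o k r o+k≡m N≡o+m 1≤r r≤k σ τ prefix suffix =
  rank-arith X B C τ-at-p σ-at-r σ-at-p σ′-at-r
  where
  T : ℕ → ℕ
  T = ent τ
  p v X B C : ℕ
  p = o ℕ.+ r
  v = T p
  X = below T v o
  B = below (window T o) v m
  C = below (window T o) v k
  1≤p : 1 ≤ p
  1≤p = ≤-trans 1≤r (m≤n+m r o)
  p≤m : p ≤ m
  p≤m = ≤-trans (+-monoʳ-≤ o r≤k) (≤-reflexive o+k≡m)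
  r≤m : r ≤ m
  r≤m = ≤-trans (m≤n+m r o) p≤m
  τ-at-p : T p ≡ suc (X ℕ.+ B)
  τ-at-p = trans (ent-rank τ p 1≤p (≤-trans p≤m (≤-trans (m≤n+m m o) (≤-reflexive (sym N≡o+m)))))
                 (cong suc (trans (cong (below T v) N≡o+m) (below-split T v o m)))
  σ-at-p : ent σ p ≡ suc (X ℕ.+ C)
  σ-at-p = trans (sym (prefix p 1≤p p≤m)) (trans (st-below T m p)
                 (cong suc (trans (cong (below T v) (sym o+k≡m)) (below-split T v o k))))
  σ-at-r : ent σ r ≡ suc B
  σ-at-r = trans (sym (suffix r 1≤r r≤m)) (st-below (window T o) m r)
  σ′-at-r : st (window (ent σ) o) k r ≡ suc C
  σ′-at-r = trans (st-cong r (≡[]-window o k (≡[]-sym prefix) (≤-reflexive o+k≡m)) 1≤r r≤k)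
                  (trans (st-window-st T m o k r (≤-reflexive o+k≡m)) (st-below (window T o) k r))

lemma3 : (m k : ℕ) → 1 ≤ k → k ≤ m ∸ 1 →
    (σ : Permutation′ m) → HasOverlap σ k →
    (τ : Permutation′ (2 * m ∸ k)) →
    st (ent τ) m ≡[ m ] ent σ →
    st (window (ent τ) (m ∸ k)) m ≡[ m ] ent σ →
    (i : ℕ) → i < k →
    + ent τ (m ∸ i)
    ≡ (+ ent σ (k ∸ i) + + ent σ (m ∸ i)) - + st (window (ent σ) (m ∸ k)) k (k ∸ i)
lemma3 m k _ k≤m∸1 σ _ τ prefix suffix i i<k =
  subst (λ p → + ent τ p ≡ (+ ent σ (k ∸ i) + + ent σ p) - + st (window (ent σ) (m ∸ k)) k (k ∸ i))
        o+r≡p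
        (overlap-entry (m ∸ k) k (k ∸ i) o+k≡m N≡o+m (m<n⇒0<n∸m i<k) (m∸n≤m k i) σ τ prefix suffix)
  where
  k≤m : k ≤ m
  k≤m = ≤-trans k≤m∸1 (m∸n≤m m 1)
  o+k≡m : m ∸ k ℕ.+ k ≡ m
  o+k≡m = m∸n+n≡m k≤m
  N≡o+m : 2 * m ∸ k ≡ m ∸ k ℕ.+ m
  N≡o+m = trans (cong (λ n → (m ℕ.+ n) ∸ k) (+-identityʳ m)) (+-∸-comm m k≤m)
  o+r≡p : m ∸ k ℕ.+ (k ∸ i) ≡ m ∸ i
  o+r≡p = trans (sym (+-∸-assoc (m ∸ k) (<⇒≤ i<k))) (cong (_∸ i) o+k≡m)
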